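{- Let $k\ge 2$, $\underline{r}=(r_1,\ldots,r_k)\in\mathbb{R}^k$, and let $(Z_n : NC^{\mathrm{(mton)}}(n)\to\mathbb{R})_{n\ge1}$ be recursive of the first kind with input $\underline{r}$. Let $\ell\in\{2,\ldots,k\}$, let $m\ge \ell$ be an integer, and let $\mathfrak{p}^{(\ell-1)} : NC^{\mathrm{(mton)}}(m)\to NC^{\mathrm{(mton)}}(m-\ell+1)$ be the $(\ell-1)$-fold iterate of the parent map $\mathfrak{p}$. (1) If $(\rho,v)\in NC^{\mathrm{(mton)}}(m)$ satisfies $|J(\rho,v)|=\ell$ and $(\sigma,w):=\mathfrak{p}^{(\ell-1)}(\rho,v)$, then $Z_m(\rho,v) = Z_{m-\ell+1}(\sigma,w) + (r_2+\cdots+r_\ell)$. (2) $\mathfrak{p}^{(\ell-1)}$ restricts to a bijection from $\{(\rho,v)\in NC^{\mathrm{(mton)}}(m) : |J(\rho,v)|=\ell\}$ onto $\{(\sigma,w)\in NC^{\mathrm{(mton)}}(m-\ell+1) : |J(\sigma,w)|=1\}$.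
   Context: $NC(n)$: non-crossing partitions of $\{1,\ldots,n\}$. For blocks $V,W$, "$V$ nested inside $W$" means $\min V>\min W$ and $\max V<\max W$. A monotonic ordering of $\pi\in NC(n)$ is a bijection $u:\pi\to\{1,\ldots,|\pi|\}$ with $u(V)>u(W)$ whenever $V$ is nested inside $W$; $NC^{\mathrm{(mton)}}(n)$ is the set of such pairs $(\pi,u)$. $J(\pi,u):=u^{ -1}(|\pi|)$ (an interval). For $n\ge2$, the parent $\mathfrak{p}(\pi,u)=(\rho,v)\in NC^{\mathrm{(mton)}}(n-1)$: with $m'=\max J(\pi,u)$ and $\phi$ the increasing bijection $\{1,\ldots,n\}\setminus\{m'\}\to\{1,\ldots,n-1\}$, $\rho=\{\phi(V\setminus\{m'\}) : V\in\pi, V\ne\{m'\}\}$ and $v(\phi(V\setminus\{m'\}))=u(V)$. $(Z_n)$ is recursive of the first kind with input $(r_1,\ldots,r_k)$ if for all $n\ge2$ and $(\pi,u)\in NC^{\mathrm{(mton)}}(n)$ with parent $(\rho,v)$: $Z_n(\pi,u)=Z_{n-1}(\rho,v)+r_j$ when $|J(\pi,u)|=j\le k$, and $Z_n(\pi,u)=Z_{n-1}(\rho,v)$ when $|J(\pi,u)|>k$. -}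

module Defs where

open import Level using (Level)
open import Data.Nat using (ℕ; zero; suc; _≤_; _<_; _+_)
open import Data.Fin using (Fin; zero; suc; toℕ; fromℕ) renaming (_<_ to _<ᶠ_; _≤_ to _≤ᶠ_)
open import Data.Fin.Properties using (_≟_)
open import Data.Vec using (Vec; []; _∷_; lookup; removeAt; count)
open import Data.Maybe using (Maybe; just; nothing; fromMaybe)
import Data.Maybe as M
open import Data.Product using (Σ; ∃; _×_; _,_)
open import Relation.Nullary using (does)
open import Relation.Binary.PropositionalEquality using (_≡_)
open import Data.Bool using (if_then_else_)
open import Algebra.Bundles using (CommutativeMonoid)

-- A pair (π , u) with π a set partition of {1,…,n} and u : π → {1,…,|π|}
-- a bijection is encoded by the map  i ↦ u(block of i) − 1, i.e. by
-- p = |π| and a vector  f : Vec (Fin p) n  (position i, 0-based, carries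
-- the label u(V) − 1 of the block V containing i+1).  The blocks of π are
-- the (nonempty) fibres of f.  Raw (possibly invalid) data:

Lab : ℕ → Set
Lab n = Σ ℕ (λ p → Vec (Fin p) n)

module _ {n p : ℕ} (f : Vec (Fin p) n) where

  IsMinOf : Fin p → Fin n → Set
  IsMinOf a i = lookup f i ≡ a × (∀ j → lookup f j ≡ a → i ≤ᶠ j)

  IsMaxOf : Fin p → Fin n → Set
  IsMaxOf a i = lookup f i ≡ a × (∀ j → lookup f j ≡ a → j ≤ᶠ i)

  record NestedIn (a b : Fin p) : Set where
    field
      minV minW maxV maxW : Fin n
      isMinV : IsMinOf a minV
      isMinW : IsMinOf b minW
      isMaxV : IsMaxOf a maxV
      isMaxW : IsMaxOf b maxW
      minW<minV : minW <ᶠ minV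
      maxV<maxW : maxV <ᶠ maxW

record IsNCm {n : ℕ} (x : Lab n) : Set where
  constructor mkNCm
  field
    -- every label 0..p-1 is used (blocks nonempty, u surjective onto {1..|π|})
    surjective : ∀ (a : Fin (Σ.proj₁ x)) → ∃ λ i → lookup (Σ.proj₂ x) i ≡ a
    nonCrossing : ∀ (a b c d : Fin n) → a <ᶠ b → b <ᶠ c → c <ᶠ d →
                  lookup (Σ.proj₂ x) a ≡ lookup (Σ.proj₂ x) c →
                  lookup (Σ.proj₂ x) b ≡ lookup (Σ.proj₂ x) d →
                  lookup (Σ.proj₂ x) a ≡ lookup (Σ.proj₂ x) b
    monotonic : ∀ (a b : Fin (Σ.proj₁ x)) → NestedIn (Σ.proj₂ x) a b → b <ᶠ a

-- |J(π,u)| : size of the block with the largest label |π| (label p-1 here)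
Jsize : {n : ℕ} → Lab n → ℕ
Jsize (zero  , f) = 0
Jsize (suc q , f) = count (_≟ fromℕ q) f

findLast : {n p : ℕ} → Fin p → Vec (Fin p) n → Maybe (Fin n)
findLast a [] = nothing
findLast a (y ∷ ys) with findLast a ys
... | just i  = just (suc i)
... | nothing = if does (y ≟ a) then just zero else nothing

lowerFin : {q : ℕ} → Fin (suc q) → Maybe (Fin q)
lowerFin {zero}  zero    = nothing
lowerFin {suc q} zero    = just zero
lowerFin {suc q} (suc i) = M.map suc (lowerFin i)

lowerAll : {q n : ℕ} → Vec (Fin (suc q)) n → Maybe (Vec (Fin q) n)
lowerAll []       = just []
lowerAll (y ∷ ys) with lowerFin y | lowerAll ys
... | just z | just zs = just (z ∷ zs)
... | _      | _       = nothing

-- If {m'} was a block (i.e. the top label no longer occurs), that block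
-- disappears and all labels are < q, so |ρ| = q and labels are kept;
-- otherwise the partition keeps q+1 blocks with the same labels.
-- (On invalid raw data the fallbacks are arbitrary.)
parent : {n : ℕ} → Lab (suc n) → Lab n
parent (zero , (() ∷ _))
parent {n} (suc q , f) with lowerAll g
  where
    m' : Fin (suc n)
    m' = fromMaybe zero (findLast (fromℕ q) f)
    g : Vec (Fin (suc q)) n
    g = removeAt f m'
... | just g' = q , g'
... | nothing = suc q , removeAt f (fromMaybe zero (findLast (fromℕ q) f))

parentIter : {n : ℕ} (j : ℕ) → Lab (j + n) → Lab n
parentIter zero    x = x
parentIter (suc j) x = parentIter j (parent x)

-- Values: an arbitrary commutative monoid (written additively as _∙_).

module _ {c ℓ : Level} (M : CommutativeMonoid c ℓ) where
  open CommutativeMonoid M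

  -- r extended by ε outside {0..k-1} (0-based: rℕ i = r_{i+1})
  rℕ : {k : ℕ} → (Fin k → Carrier) → ℕ → Carrier
  rℕ {zero}  r i       = ε
  rℕ {suc k} r zero    = r zero
  rℕ {suc k} r (suc i) = rℕ (λ j → r (suc j)) i

  -- rsum r j = r_2 + r_3 + ⋯ + r_{j+1}
  rsum : {k : ℕ} → (Fin k → Carrier) → ℕ → Carrier
  rsum r zero    = ε
  rsum r (suc j) = rsum r j ∙ rℕ r (suc j)

  IsRecursive : (k : ℕ) → (Fin k → Carrier) → ((n : ℕ) → Lab n → Carrier) → Set _
  IsRecursive k r Z =
    ∀ (n : ℕ) (x : Lab (suc (suc n))) → IsNCm x →
      (∀ (i : Fin k) → Jsize x ≡ suc (toℕ i) →
          Z (suc (suc n)) x ≈ (Z (suc n) (parent x) ∙ r i))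
      × (k < Jsize x → Z (suc (suc n)) x ≈ Z (suc n) (parent x))

{-# OPTIONS --safe #-}
-- If |J| ≥ 2 then J is an interval: a block with an element strictly between two elements of J
-- is, by non-crossingness, nested inside J, which is impossible since J carries the largest
-- label.  So max J − 1 ∈ J, the parent map merely deletes max J from J (every label survives),
-- and growJ, which inserts a copy of the top label right after max J, undoes it.  Duplicating a
-- position is a pullback along the monotone surjection pinch, and such pullbacks preserve and
-- reflect non-crossingness and the nesting relation, hence monotonicity of the ordering.  Thus
-- parent is a bijection from {|J| = j + 2} onto {|J| = j + 1}, each step adding r_{j+2} to Z;
-- iterating it ℓ − 1 times gives both parts.
module Submission where

open import Defs
open import Level using (Level)
open import Data.Nat using (ℕ; zero; suc; _+_; _∸_; _≤_; _<_; z≤n; s≤s; s≤s⁻¹)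
open import Data.Nat.Properties using (≤-trans; ≤-refl; ≤-reflexive; <⇒≤; <⇒≱; ≰⇒>; ≤-<-trans; <-≤-trans; n≤1+n; m≤n+m; suc-injective)
open import Data.Fin using (Fin; zero; suc; toℕ; fromℕ; fromℕ<; punchIn; pinch) renaming (_≤_ to _≤ᶠ_; _<_ to _<ᶠ_)
open import Data.Fin.Properties using (_≟_; ≤∧≢⇒<; ≤-antisym; ≤fromℕ; toℕ-fromℕ<; punchInᵢ≢i; punchIn-cancel-≤; pinch-mono-≤; pinch-surjective)
open import Data.Vec using (Vec; []; _∷_; lookup; insertAt; removeAt; count)
open import Data.Vec.Properties using (insertAt-lookup; insertAt-punchIn; removeAt-insertAt; insertAt-removeAt)
open import Data.Maybe using (Maybe; just; nothing; fromMaybe)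
open import Data.Product using (∃; _×_; _,_; proj₁; proj₂)
open import Data.Empty using (⊥-elim)
open import Function using (_∘_)
open import Relation.Nullary using (¬_; yes; no)
open import Relation.Unary using (Pred; Decidable)
open import Relation.Binary.PropositionalEquality using (_≡_; _≢_; refl; sym; trans; cong; subst; subst₂; module ≡-Reasoning)
open import Algebra.Bundles using (CommutativeMonoid)
import Relation.Binary.Reasoning.Setoid as SetoidReasoning

IsMinOf-unique : ∀ {p n} {f : Vec (Fin p) n} {a i j} → IsMinOf f a i → IsMinOf f a j → i ≡ j
IsMinOf-unique (fi , i-min) (fj , j-min) = ≤-antisym (i-min _ fj) (j-min _ fi)

IsMaxOf-unique : ∀ {p n} {f : Vec (Fin p) n} {a i j} → IsMaxOf f a i → IsMaxOf f a j → i ≡ j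
IsMaxOf-unique (fi , i-max) (fj , j-max) = ≤-antisym (j-max _ fi) (i-max _ fj)

IsMinOf-exists : ∀ {p n} (f : Vec (Fin p) n) {a} (i : Fin n) → lookup f i ≡ a → ∃ (IsMinOf f a)
IsMinOf-exists (x ∷ xs) {a} i fi with x ≟ a
... | yes x≡a = zero , x≡a , λ _ _ → z≤n
IsMinOf-exists (x ∷ xs) zero    fi | no x≢a = ⊥-elim (x≢a fi)
IsMinOf-exists (x ∷ xs) (suc i) fi | no x≢a with IsMinOf-exists xs i fi
... | m , xsm , m-min = suc m , xsm , λ { zero x≡a → ⊥-elim (x≢a x≡a) ; (suc j) fj → s≤s (m-min j fj) }

LastOccurrence : ∀ {p n} → Vec (Fin p) n → Fin p → Maybe (Fin n) → Set
LastOccurrence f a (just i) = IsMaxOf f a i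
LastOccurrence f a nothing  = ∀ j → lookup f j ≢ a

findLast-correct : ∀ {p n} (a : Fin p) (f : Vec (Fin p) n) → LastOccurrence f a (findLast a f)
findLast-correct a []       = λ ()
findLast-correct a (x ∷ xs) with findLast a xs | findLast-correct a xs
... | just i  | (xsi , i-max) = xsi , λ { zero _ → z≤n ; (suc j) xsj → s≤s (i-max j xsj) }
... | nothing | absent with x ≟ a
...   | yes x≡a = x≡a , λ { zero _ → z≤n ; (suc j) xsj → ⊥-elim (absent j xsj) }
...   | no x≢a  = λ { zero x≡a → x≢a x≡a ; (suc j) xsj → absent j xsj }

IsMaxOf-exists : ∀ {p n} (f : Vec (Fin p) n) {a} (i : Fin n) → lookup f i ≡ a → ∃ (IsMaxOf f a)
IsMaxOf-exists f {a} i fi with findLast a f | findLast-correct a f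
... | just m  | m-max  = m , m-max
... | nothing | absent = ⊥-elim (absent i fi)

findLast-IsMaxOf : ∀ {p n} (f : Vec (Fin p) n) {a m} → IsMaxOf f a m → findLast a f ≡ just m
findLast-IsMaxOf f {a} m-max with findLast a f | findLast-correct a f
... | just m′ | m′-max = cong just (IsMaxOf-unique {f = f} m′-max m-max)
... | nothing | absent = ⊥-elim (absent _ (proj₁ m-max))

module _ {a ℓ} {A : Set a} {P : Pred A ℓ} (P? : Decidable P) where

  count-insertAt : ∀ {n} (xs : Vec A n) (i : Fin (suc n)) {v} → P v → count P? (insertAt xs i v) ≡ suc (count P? xs)
  count-insertAt xs zero {v} pv with P? v
  ... | yes _  = refl
  ... | no ¬pv = ⊥-elim (¬pv pv)
  count-insertAt (x ∷ xs) (suc i) pv with P? x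
  ... | yes _ = cong suc (count-insertAt xs i pv)
  ... | no _  = count-insertAt xs i pv

  count≡suc⇒∃ : ∀ {n j} (xs : Vec A n) → count P? xs ≡ suc j → ∃ λ i → P (lookup xs i)
  count≡suc⇒∃ (x ∷ xs) c≡ with P? x
  ... | yes px = zero , px
  ... | no _   = let (i , pi) = count≡suc⇒∃ xs c≡ in suc i , pi

NonCrossing : ∀ {p n} → Vec (Fin p) n → Set
NonCrossing {n = n} f = ∀ (a b c d : Fin n) → a <ᶠ b → b <ᶠ c → c <ᶠ d →
  lookup f a ≡ lookup f c → lookup f b ≡ lookup f d → lookup f a ≡ lookup f b

NestedIn-irrefl : ∀ {p n} {f : Vec (Fin p) n} {a b} → NestedIn f a b → a ≢ b
NestedIn-irrefl nst refl = <⇒≱ minW<minV (proj₂ isMinV minW (proj₁ isMinW))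
  where open NestedIn nst

module Pullback {p N M : ℕ} (f : Vec (Fin p) N) (g : Vec (Fin p) M)
                (σ : Fin N → Fin M) (σ-mono : ∀ {i j} → i ≤ᶠ j → σ i ≤ᶠ σ j)
                (τ : Fin M → Fin N) (σ∘τ : ∀ i → σ (τ i) ≡ i)
                (f≗g∘σ : ∀ i → lookup f i ≡ lookup g (σ i)) where

  g≗f∘τ : ∀ i → lookup g i ≡ lookup f (τ i)
  g≗f∘τ i = sym (trans (f≗g∘σ (τ i)) (cong (lookup g) (σ∘τ i)))

  ≡-down : ∀ {i j} → lookup f i ≡ lookup f j → lookup g (σ i) ≡ lookup g (σ j)
  ≡-down {i} {j} e = trans (sym (f≗g∘σ i)) (trans e (f≗g∘σ j))

  ≡-up : ∀ {i j} → lookup g (σ i) ≡ lookup g (σ j) → lookup f i ≡ lookup f j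
  ≡-up {i} {j} e = trans (f≗g∘σ i) (trans e (sym (f≗g∘σ j)))

  ≡-τ : ∀ {i j} → lookup g i ≡ lookup g j → lookup f (τ i) ≡ lookup f (τ j)
  ≡-τ {i} {j} e = trans (sym (g≗f∘τ i)) (trans e (g≗f∘τ j))

  σ-cancel-< : ∀ {i j} → σ i <ᶠ σ j → i <ᶠ j
  σ-cancel-< σi<σj = ≰⇒> (λ j≤i → <⇒≱ σi<σj (σ-mono j≤i))

  σ-strict : ∀ {i j} → i <ᶠ j → lookup f i ≢ lookup f j → σ i <ᶠ σ j
  σ-strict i<j fi≢fj = ≤∧≢⇒< (σ-mono (<⇒≤ i<j)) (fi≢fj ∘ ≡-up ∘ cong (lookup g))

  τ-strict : ∀ {i j} → i <ᶠ j → τ i <ᶠ τ j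
  τ-strict {i} {j} i<j = σ-cancel-< (subst₂ _<ᶠ_ (sym (σ∘τ i)) (sym (σ∘τ j)) i<j)

  nonCrossing-up : NonCrossing g → NonCrossing f
  nonCrossing-up nc a b c d a<b b<c c<d ac bd
    with lookup f a ≟ lookup f b | lookup f b ≟ lookup f c | lookup f c ≟ lookup f d
  ... | yes ab | _      | _      = ab
  ... | no _   | yes bc | _      = trans ac (sym bc)
  ... | no _   | no _   | yes cd = trans ac (trans cd (sym bd))
  ... | no ab  | no bc  | no cd  =
    ≡-up (nc _ _ _ _ (σ-strict a<b ab) (σ-strict b<c bc) (σ-strict c<d cd) (≡-down ac) (≡-down bd))

  nonCrossing-down : NonCrossing f → NonCrossing g
  nonCrossing-down nc a b c d a<b b<c c<d ac bd = begin
    lookup g a      ≡⟨ g≗f∘τ a ⟩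
    lookup f (τ a)  ≡⟨ nc _ _ _ _ (τ-strict a<b) (τ-strict b<c) (τ-strict c<d) (≡-τ ac) (≡-τ bd) ⟩
    lookup f (τ b)  ≡⟨ g≗f∘τ b ⟨
    lookup g b      ∎
    where open ≡-Reasoning

  IsMinOf-down : ∀ {a i} → IsMinOf f a i → IsMinOf g a (σ i)
  IsMinOf-down {i = i} (fi , i-min) =
    trans (sym (f≗g∘σ i)) fi ,
    λ j gj → subst (σ i ≤ᶠ_) (σ∘τ j) (σ-mono (i-min (τ j) (trans (sym (g≗f∘τ j)) gj)))

  IsMaxOf-down : ∀ {a i} → IsMaxOf f a i → IsMaxOf g a (σ i)
  IsMaxOf-down {i = i} (fi , i-max) =
    trans (sym (f≗g∘σ i)) fi ,
    λ j gj → subst (_≤ᶠ σ i) (σ∘τ j) (σ-mono (i-max (τ j) (trans (sym (g≗f∘τ j)) gj)))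

  IsMinOf-up : ∀ {a i} → IsMinOf g a i → ∃ λ i′ → IsMinOf f a i′ × σ i′ ≡ i
  IsMinOf-up {i = i} i-min =
    let (i′ , i′-min) = IsMinOf-exists f (τ i) (trans (sym (g≗f∘τ i)) (proj₁ i-min))
    in i′ , i′-min , IsMinOf-unique {f = g} (IsMinOf-down i′-min) i-min

  IsMaxOf-up : ∀ {a i} → IsMaxOf g a i → ∃ λ i′ → IsMaxOf f a i′ × σ i′ ≡ i
  IsMaxOf-up {i = i} i-max =
    let (i′ , i′-max) = IsMaxOf-exists f (τ i) (trans (sym (g≗f∘τ i)) (proj₁ i-max))
    in i′ , i′-max , IsMaxOf-unique {f = g} (IsMaxOf-down i′-max) i-max

  NestedIn-down : ∀ {a b} → NestedIn f a b → NestedIn g a b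
  NestedIn-down nst = record
    { minV = σ minV ; minW = σ minW ; maxV = σ maxV ; maxW = σ maxW
    ; isMinV = IsMinOf-down isMinV ; isMinW = IsMinOf-down isMinW
    ; isMaxV = IsMaxOf-down isMaxV ; isMaxW = IsMaxOf-down isMaxW
    ; minW<minV = σ-strict minW<minV (λ e → a≢b (trans (sym (proj₁ isMinV)) (trans (sym e) (proj₁ isMinW))))
    ; maxV<maxW = σ-strict maxV<maxW (λ e → a≢b (trans (sym (proj₁ isMaxV)) (trans e (proj₁ isMaxW))))
    }
    where
    open NestedIn nst
    a≢b = NestedIn-irrefl nst

  NestedIn-up : ∀ {a b} → NestedIn g a b → NestedIn f a b
  NestedIn-up nst =
    let (minV′ , minV′-min , σminV′) = IsMinOf-up isMinV
        (minW′ , minW′-min , σminW′) = IsMinOf-up isMinW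
        (maxV′ , maxV′-max , σmaxV′) = IsMaxOf-up isMaxV
        (maxW′ , maxW′-max , σmaxW′) = IsMaxOf-up isMaxW
    in record
      { minV = minV′ ; minW = minW′ ; maxV = maxV′ ; maxW = maxW′
      ; isMinV = minV′-min ; isMinW = minW′-min ; isMaxV = maxV′-max ; isMaxW = maxW′-max
      ; minW<minV = σ-cancel-< (subst₂ _<ᶠ_ (sym σminW′) (sym σminV′) minW<minV)
      ; maxV<maxW = σ-cancel-< (subst₂ _<ᶠ_ (sym σmaxV′) (sym σmaxW′) maxV<maxW)
      }
    where open NestedIn nst

  preserves : IsNCm (p , g) → IsNCm (p , f)
  preserves (mkNCm surj nc mono) = mkNCm
    (λ a → let (i , gi) = surj a in τ i , trans (sym (g≗f∘τ i)) gi)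
    (nonCrossing-up nc)
    (λ a b nst → mono a b (NestedIn-down nst))

  reflects : IsNCm (p , f) → IsNCm (p , g)
  reflects (mkNCm surj nc mono) = mkNCm
    (λ a → let (i , fi) = surj a in σ i , trans (sym (f≗g∘σ i)) fi)
    (nonCrossing-down nc)
    (λ a b nst → mono a b (NestedIn-up nst))

lookup-insertAt-copy : ∀ {A : Set} {m} (xs : Vec A m) (s : Fin m) {v} → lookup xs s ≡ v →
                       ∀ j → lookup (insertAt xs (suc s) v) j ≡ lookup xs (pinch s j)
lookup-insertAt-copy (x ∷ xs)     zero    x≡v  zero          = refl
lookup-insertAt-copy (x ∷ xs)     zero    x≡v  (suc zero)    = sym x≡v
lookup-insertAt-copy (x ∷ xs)     zero    x≡v  (suc (suc j)) = refl
lookup-insertAt-copy (x ∷ y ∷ xs) (suc s) xs≡v zero          = refl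
lookup-insertAt-copy (x ∷ y ∷ xs) (suc s) xs≡v (suc j)       = lookup-insertAt-copy (y ∷ xs) s xs≡v j

toℕ≤suc-pinch : ∀ {m} (s : Fin m) (j : Fin (suc m)) → toℕ j ≤ suc (toℕ (pinch s j))
toℕ≤suc-pinch zero    zero    = z≤n
toℕ≤suc-pinch zero    (suc j) = ≤-refl
toℕ≤suc-pinch (suc s) zero    = z≤n
toℕ≤suc-pinch (suc s) (suc j) = s≤s (toℕ≤suc-pinch s j)

pinch-section : ∀ {m} → Fin m → Fin m → Fin (suc m)
pinch-section s i = proj₁ (pinch-surjective s i)

pinch-pinch-section : ∀ {m} (s i : Fin m) → pinch s (pinch-section s i) ≡ i
pinch-pinch-section s i = proj₂ (pinch-surjective s i) refl

module _ {p m : ℕ} {h : Vec (Fin p) m} {s : Fin m} {v : Fin p} (hs≡v : lookup h s ≡ v) where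

  private
    module Copy = Pullback (insertAt h (suc s) v) h (pinch s) (pinch-mono-≤ s)
                           (pinch-section s) (pinch-pinch-section s) (lookup-insertAt-copy h s hs≡v)

  IsNCm-insertAt-copy : IsNCm (p , h) → IsNCm (p , insertAt h (suc s) v)
  IsNCm-insertAt-copy = Copy.preserves

  IsNCm-insertAt-copy⁻ : IsNCm (p , insertAt h (suc s) v) → IsNCm (p , h)
  IsNCm-insertAt-copy⁻ = Copy.reflects

  IsMaxOf-insertAt-copy : IsMaxOf h v s → IsMaxOf (insertAt h (suc s) v) v (suc s)
  IsMaxOf-insertAt-copy (_ , s-max) =
    insertAt-lookup h (suc s) v ,
    λ j fj → ≤-trans (toℕ≤suc-pinch s j) (s≤s (s-max (pinch s j) (trans (sym (lookup-insertAt-copy h s hs≡v j)) fj)))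

nestedIn-between : ∀ {p n} {f : Vec (Fin p) n} {i c k} → NonCrossing f → lookup f i ≡ lookup f k →
                   i <ᶠ c → c <ᶠ k → lookup f c ≢ lookup f i → NestedIn f (lookup f c) (lookup f i)
nestedIn-between {f = f} {i} {c} {k} nc fi≡fk i<c c<k fc≢fi =
  let (vmin , vmin-min) = IsMinOf-exists f c refl
      (vmax , vmax-max) = IsMaxOf-exists f c refl
      (wmin , wmin-min) = IsMinOf-exists f i refl
      (wmax , wmax-max) = IsMaxOf-exists f i refl
      i<vmin : i <ᶠ vmin
      i<vmin = ≰⇒> λ vmin≤i →
        let vmin<i = ≤∧≢⇒< vmin≤i (λ { refl → fc≢fi (sym (proj₁ vmin-min)) })
        in fc≢fi (trans (sym (proj₁ vmin-min)) (nc vmin i c k vmin<i i<c c<k (proj₁ vmin-min) fi≡fk))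
      vmax<k : vmax <ᶠ k
      vmax<k = ≰⇒> λ k≤vmax →
        let k<vmax = ≤∧≢⇒< k≤vmax (λ { refl → fc≢fi (trans (sym (proj₁ vmax-max)) (sym fi≡fk)) })
        in fc≢fi (sym (nc i c k vmax i<c c<k k<vmax fi≡fk (sym (proj₁ vmax-max))))
  in record
    { minV = vmin ; minW = wmin ; maxV = vmax ; maxW = wmax
    ; isMinV = vmin-min ; isMinW = wmin-min ; isMaxV = vmax-max ; isMaxW = wmax-max
    ; minW<minV = ≤-<-trans (proj₂ wmin-min i refl) i<vmin
    ; maxV<maxW = <-≤-trans vmax<k (proj₂ wmax-max k (sym fi≡fk))
    }

nothing-nestedIn-top : ∀ {q n} {f : Vec (Fin (suc q)) n} {b} → IsNCm (suc q , f) → ¬ NestedIn f b (fromℕ q)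
nothing-nestedIn-top v nst = <⇒≱ (IsNCm.monotonic v _ _ nst) (≤fromℕ _)

J-convex : ∀ {q n} {f : Vec (Fin (suc q)) n} {i c k} → IsNCm (suc q , f) →
           lookup f i ≡ fromℕ q → lookup f k ≡ fromℕ q → i ≤ᶠ c → c ≤ᶠ k → lookup f c ≡ fromℕ q
J-convex {q} {f = f} {i} {c} {k} v fi fk i≤c c≤k with lookup f c ≟ fromℕ q
... | yes fc = fc
... | no fc≢top = ⊥-elim (nothing-nestedIn-top v (subst (NestedIn f (lookup f c)) fi nested))
  where
  i<c = ≤∧≢⇒< i≤c (λ { refl → fc≢top fi })
  c<k = ≤∧≢⇒< c≤k (λ { refl → fc≢top fk })
  nested = nestedIn-between (IsNCm.nonCrossing v) (trans fi (sym fk)) i<c c<k (λ fc≡fi → fc≢top (trans fc≡fi fi))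

toℕ-punchIn-suc-self : ∀ {n} (i : Fin n) → toℕ (punchIn (suc i) i) ≡ toℕ i
toℕ-punchIn-suc-self zero    = refl
toℕ-punchIn-suc-self (suc i) = cong suc (toℕ-punchIn-suc-self i)

punchIn-<-max : ∀ {p n} (g : Vec (Fin p) n) (m : Fin (suc n)) {a j} →
                IsMaxOf (insertAt g m a) a m → lookup g j ≡ a → punchIn m j <ᶠ m
punchIn-<-max g m {a} {j} (_ , m-max) gj =
  ≤∧≢⇒< (m-max (punchIn m j) (trans (insertAt-punchIn g m a j) gj)) (punchInᵢ≢i m j)

maxJ-predecessor : ∀ {q n} (g : Vec (Fin (suc q)) n) (m : Fin (suc n)) {j} →
                   IsNCm (suc q , insertAt g m (fromℕ q)) → IsMaxOf (insertAt g m (fromℕ q)) (fromℕ q) m →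
                   lookup g j ≡ fromℕ q → ∃ λ s → m ≡ suc s × IsMaxOf g (fromℕ q) s
maxJ-predecessor g zero v m-max gj with punchIn-<-max g zero m-max gj
... | ()
maxJ-predecessor {q} g (suc s) {j} v m-max gj =
  s , refl , gs , λ j′ gj′ → punchIn-cancel-≤ (suc s) j′ s (≤s′ (punchIn-<-max g (suc s) m-max gj′))
  where
  s′ = punchIn (suc s) s
  ≤s′ : ∀ {x} → x <ᶠ suc s → x ≤ᶠ s′
  ≤s′ x<ss = ≤-trans (s≤s⁻¹ x<ss) (≤-reflexive (sym (toℕ-punchIn-suc-self s)))
  gs : lookup g s ≡ fromℕ q
  gs = trans (sym (insertAt-punchIn g (suc s) (fromℕ q) s))
             (J-convex v (trans (insertAt-punchIn g (suc s) (fromℕ q) j) gj) (proj₁ m-max)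
                       (≤s′ (punchIn-<-max g (suc s) m-max gj))
                       (≤-trans (≤-reflexive (toℕ-punchIn-suc-self s)) (n≤1+n _)))

lowerFin-fromℕ : ∀ q → lowerFin (fromℕ q) ≡ nothing
lowerFin-fromℕ zero    = refl
lowerFin-fromℕ (suc q) rewrite lowerFin-fromℕ q = refl

lowerAll-top : ∀ {q n} (g : Vec (Fin (suc q)) n) {j} → lookup g j ≡ fromℕ q → lowerAll g ≡ nothing
lowerAll-top {q} (x ∷ xs) {zero} refl rewrite lowerFin-fromℕ q = refl
lowerAll-top (x ∷ xs) {suc j} xsj with lowerFin x
... | nothing = refl
... | just _  rewrite lowerAll-top xs xsj = refl

parent-removeAt : ∀ {q n} (f : Vec (Fin (suc q)) (suc n)) {m j} → IsMaxOf f (fromℕ q) m →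
                  lookup (removeAt f m) j ≡ fromℕ q → parent (suc q , f) ≡ (suc q , removeAt f m)
parent-removeAt {q} f {m} m-max gj
  -- the scrutinee of the with-clause in the definition of parent
  with lowerAll (removeAt f (fromMaybe zero (findLast (fromℕ q) f))) | keepsTop
  where
  keepsTop : lowerAll (removeAt f (fromMaybe zero (findLast (fromℕ q) f))) ≡ nothing
  keepsTop rewrite findLast-IsMaxOf f m-max = lowerAll-top (removeAt f m) gj
... | nothing | refl = cong (λ l → suc q , removeAt f (fromMaybe zero l)) (findLast-IsMaxOf f m-max)

parent-insertAt : ∀ {q n} (g : Vec (Fin (suc q)) n) (m : Fin (suc n)) {j} → lookup g j ≡ fromℕ q →
                  IsMaxOf (insertAt g m (fromℕ q)) (fromℕ q) m → parent (suc q , insertAt g m (fromℕ q)) ≡ (suc q , g)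
parent-insertAt {q} g m {j} gj m-max =
  trans (parent-removeAt (insertAt g m (fromℕ q)) m-max (subst (λ h → lookup h j ≡ fromℕ q) (sym removed) gj))
        (cong (suc q ,_) removed)
  where removed = removeAt-insertAt g m (fromℕ q)

-- On Lab 0, where J is empty, the value is junk.
growJ : ∀ {m} → Lab m → Lab (suc m)
growJ {zero}  _                  = 1 , zero ∷ []
growJ {suc m} (zero  , (() ∷ _))
growJ {suc m} (suc q , h)        = suc q , insertAt h (suc (fromMaybe zero (findLast (fromℕ q) h))) (fromℕ q)

data MaxJ : ∀ {m} → Lab m → Set where
  maxJ : ∀ {q m} {h : Vec (Fin (suc q)) m} (s : Fin m) → IsMaxOf h (fromℕ q) s → MaxJ (suc q , h)

maxJ-exists : ∀ {m j} (y : Lab m) → Jsize y ≡ suc j → MaxJ y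
maxJ-exists (zero  , h) ()
maxJ-exists (suc q , h) J≡ =
  let (i , hi) = count≡suc⇒∃ (_≟ fromℕ q) h J≡
      (s , s-max) = IsMaxOf-exists h i hi
  in maxJ s s-max

growJ-maxJ : ∀ {q m} {h : Vec (Fin (suc q)) m} {s} → IsMaxOf h (fromℕ q) s →
             growJ (suc q , h) ≡ (suc q , insertAt h (suc s) (fromℕ q))
growJ-maxJ {h = []} {()}
growJ-maxJ {q} {h = h@(_ ∷ _)} s-max =
  cong (λ l → suc q , insertAt h (suc (fromMaybe zero l)) (fromℕ q)) (findLast-IsMaxOf h s-max)

IsNCm-growJ : ∀ {m} {y : Lab m} → MaxJ y → IsNCm y → IsNCm (growJ y)
IsNCm-growJ (maxJ {h = h} s s-max) rewrite growJ-maxJ {h = h} s-max = IsNCm-insertAt-copy (proj₁ s-max)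

IsNCm-growJ⁻ : ∀ {m} {y : Lab m} → MaxJ y → IsNCm (growJ y) → IsNCm y
IsNCm-growJ⁻ (maxJ {h = h} s s-max) rewrite growJ-maxJ {h = h} s-max = IsNCm-insertAt-copy⁻ (proj₁ s-max)

Jsize-growJ : ∀ {m} {y : Lab m} → MaxJ y → Jsize (growJ y) ≡ suc (Jsize y)
Jsize-growJ (maxJ {h = h} s s-max) rewrite growJ-maxJ {h = h} s-max = count-insertAt (_≟ _) h (suc s) refl

parent-growJ : ∀ {m} {y : Lab m} → MaxJ y → parent (growJ y) ≡ y
parent-growJ (maxJ {h = h} s s-max) rewrite growJ-maxJ {h = h} s-max =
  parent-insertAt h (suc s) (proj₁ s-max) (IsMaxOf-insertAt-copy {h = h} (proj₁ s-max) s-max)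

growJ-parent-insertAt : ∀ {q n j} {f : Vec (Fin (suc q)) (suc n)} (g : Vec (Fin (suc q)) n) (m : Fin (suc n)) →
                        f ≡ insertAt g m (fromℕ q) → IsNCm (suc q , f) → IsMaxOf f (fromℕ q) m →
                        Jsize (suc q , f) ≡ suc (suc j) → MaxJ (parent (suc q , f)) × growJ (parent (suc q , f)) ≡ (suc q , f)
growJ-parent-insertAt {q} g m refl v m-max J≡
  with count≡suc⇒∃ (_≟ fromℕ q) g (suc-injective (trans (sym (count-insertAt (_≟ fromℕ q) g m refl)) J≡))
... | j , gj with maxJ-predecessor g m v m-max gj
... | s , refl , s-max rewrite parent-insertAt g (suc s) gj m-max = maxJ s s-max , growJ-maxJ s-max

growJ-parent : ∀ {n j} (x : Lab (suc n)) → IsNCm x → Jsize x ≡ suc (suc j) → MaxJ (parent x) × growJ (parent x) ≡ x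
growJ-parent x v J≡ with maxJ-exists x J≡
... | maxJ {q} {h = f} m m-max =
  growJ-parent-insertAt (removeAt f m) m (sym split) v m-max J≡
  where
  split : insertAt (removeAt f m) m (fromℕ q) ≡ f
  split = trans (cong (insertAt (removeAt f m) m) (sym (proj₁ m-max))) (insertAt-removeAt f m)

IsNCm-parent : ∀ {n j} (x : Lab (suc n)) → IsNCm x → Jsize x ≡ suc (suc j) → IsNCm (parent x)
IsNCm-parent x v J≡ =
  let (parent-maxJ , grow≡x) = growJ-parent x v J≡
  in IsNCm-growJ⁻ parent-maxJ (subst IsNCm (sym grow≡x) v)

Jsize-parent : ∀ {n j} (x : Lab (suc n)) → IsNCm x → Jsize x ≡ suc (suc j) → Jsize (parent x) ≡ suc j
Jsize-parent x v J≡ =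
  let (parent-maxJ , grow≡x) = growJ-parent x v J≡
  in suc-injective (trans (sym (Jsize-growJ parent-maxJ)) (trans (cong Jsize grow≡x) J≡))

parentIter-NCm : ∀ j {n} (x : Lab (j + n)) → IsNCm x → Jsize x ≡ suc j →
                 IsNCm (parentIter j x) × Jsize (parentIter j x) ≡ 1
parentIter-NCm zero    x v J≡ = v , J≡
parentIter-NCm (suc j) x v J≡ = parentIter-NCm j (parent x) (IsNCm-parent x v J≡) (Jsize-parent x v J≡)

parentIter-injective : ∀ j {n} (x y : Lab (j + n)) → IsNCm x → Jsize x ≡ suc j → IsNCm y → Jsize y ≡ suc j →
                       parentIter j x ≡ parentIter j y → x ≡ y
parentIter-injective zero    x y _  _  _  _  x≡y = x≡y
parentIter-injective (suc j) x y vx Jx vy Jy eq = begin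
  x                 ≡⟨ proj₂ (growJ-parent x vx Jx) ⟨
  growJ (parent x)  ≡⟨ cong growJ parents≡ ⟩
  growJ (parent y)  ≡⟨ proj₂ (growJ-parent y vy Jy) ⟩
  y                 ∎
  where
  open ≡-Reasoning
  parents≡ = parentIter-injective j (parent x) (parent y)
               (IsNCm-parent x vx Jx) (Jsize-parent x vx Jx) (IsNCm-parent y vy Jy) (Jsize-parent y vy Jy) eq

parentIter-surjective : ∀ j {n} (y : Lab n) → IsNCm y → Jsize y ≡ 1 →
                        ∃ λ (x : Lab (j + n)) → IsNCm x × Jsize x ≡ suc j × parentIter j x ≡ y
parentIter-surjective zero    y v J≡ = y , v , J≡ , refl
parentIter-surjective (suc j) y v J≡ =
  let (x , vx , Jx , x↦y) = parentIter-surjective j y v J≡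
      x-maxJ = maxJ-exists x Jx
  in growJ x , IsNCm-growJ x-maxJ vx , trans (Jsize-growJ x-maxJ) (cong suc Jx) ,
     trans (cong (parentIter j) (parent-growJ x-maxJ)) x↦y

rℕ-fromℕ< : ∀ {c ℓ} (M : CommutativeMonoid c ℓ) {k} (r : Fin k → CommutativeMonoid.Carrier M) {j} (j<k : j < k) →
            rℕ M r j ≡ r (fromℕ< j<k)
rℕ-fromℕ< M r {zero}  (s≤s _)   = refl
rℕ-fromℕ< M r {suc j} (s≤s j<k) = rℕ-fromℕ< M (r ∘ suc) j<k

module _ {c ℓ} (M : CommutativeMonoid c ℓ) {k : ℕ} (r : Fin k → CommutativeMonoid.Carrier M)
         (Z : (n : ℕ) → Lab n → CommutativeMonoid.Carrier M) (rec : IsRecursive M k r Z) where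

  open CommutativeMonoid M using (_≈_; _∙_; setoid; identityʳ; ∙-congʳ; assoc) renaming (sym to ≈-sym)
  open SetoidReasoning setoid

  Z-parent : ∀ {m j} (x : Lab (suc m)) → 1 ≤ m → IsNCm x → Jsize x ≡ suc j → (j<k : j < k) →
             Z (suc m) x ≈ Z m (parent x) ∙ rℕ M r j
  Z-parent {suc m} x _ v J≡ j<k rewrite rℕ-fromℕ< M r j<k =
    proj₁ (rec m x v) (fromℕ< j<k) (trans J≡ (cong suc (sym (toℕ-fromℕ< j<k))))

  Z-parentIter : ∀ j {n} → 1 ≤ n → j < k → (x : Lab (j + n)) → IsNCm x → Jsize x ≡ suc j →
                 Z (j + n) x ≈ Z n (parentIter j x) ∙ rsum M r j
  Z-parentIter zero    _   _    x v J≡ = ≈-sym (identityʳ _)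
  Z-parentIter (suc j) {n} 1≤n j<k x v J≡ = begin
    Z (suc (j + n)) x                                              ≈⟨ Z-parent x (≤-trans 1≤n (m≤n+m n j)) v J≡ j<k ⟩
    Z (j + n) (parent x) ∙ rℕ M r (suc j)                          ≈⟨ ∙-congʳ IH ⟩
    (Z n (parentIter (suc j) x) ∙ rsum M r j) ∙ rℕ M r (suc j)     ≈⟨ assoc _ _ _ ⟩
    Z n (parentIter (suc j) x) ∙ rsum M r (suc j)                  ∎
    where
    IH = Z-parentIter j 1≤n (≤-trans (n≤1+n _) j<k) (parent x) (IsNCm-parent x v J≡) (Jsize-parent x v J≡)

lemma3p3 : ∀ {c ℓ' : Level} (M : CommutativeMonoid c ℓ') (k : ℕ) → 2 ≤ k →
    (r : Fin k → CommutativeMonoid.Carrier M) →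
    (Z : (n : ℕ) → Lab n → CommutativeMonoid.Carrier M) →
    IsRecursive M k r Z →
    (ℓ : ℕ) → 2 ≤ ℓ → ℓ ≤ k →
    (t : ℕ) → 1 ≤ t →
    -- m = (ℓ - 1) + t, so m ≥ ℓ and m - ℓ + 1 = t
    (∀ (x : Lab ((ℓ ∸ 1) + t)) → IsNCm x → Jsize x ≡ ℓ →
        CommutativeMonoid._≈_ M (Z ((ℓ ∸ 1) + t) x)
          (CommutativeMonoid._∙_ M (Z t (parentIter (ℓ ∸ 1) x)) (rsum M r (ℓ ∸ 1))))
    × ((∀ (x : Lab ((ℓ ∸ 1) + t)) → IsNCm x → Jsize x ≡ ℓ →
          IsNCm (parentIter (ℓ ∸ 1) x) × Jsize (parentIter (ℓ ∸ 1) x) ≡ 1)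
      × (∀ (x y : Lab ((ℓ ∸ 1) + t)) → IsNCm x → Jsize x ≡ ℓ → IsNCm y → Jsize y ≡ ℓ →
          parentIter (ℓ ∸ 1) x ≡ parentIter (ℓ ∸ 1) y → x ≡ y)
      × (∀ (y : Lab t) → IsNCm y → Jsize y ≡ 1 →
          ∃ λ (x : Lab ((ℓ ∸ 1) + t)) → IsNCm x × Jsize x ≡ ℓ × parentIter (ℓ ∸ 1) x ≡ y))
lemma3p3 M k _ r Z rec zero    () _ t 1≤t
lemma3p3 M k _ r Z rec (suc j) _ ℓ≤k t 1≤t =
  Z-parentIter M r Z rec j 1≤t ℓ≤k , parentIter-NCm j , parentIter-injective j , parentIter-surjective j
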